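{- The following two statements are equivalent. (A) For every positive integer $n$ and all distinct positive integers $a_1,\dots,a_n$, one has $\max_{i,j}\frac{a_i}{\gcd(a_i,a_j)}\ge n$. (B) For every positive integer $n$ and every subset $S\subseteq F_n$ with $\mathcal{Q}(S)\subseteq F_n$, one has $|S|\le n+1$.
   Context: For a positive integer $n$, $F_n$ (the Farey sequence of order $n$) is the set of rational numbers $a/b$ with integers $0\le a\le b\le n$, $b\ge 1$, $\gcd(a,b)=1$. For a set $S$ of real numbers, $\mathcal{Q}(S)=\{x/y : x,y\in S,\ x\le y,\ y\neq 0\}$; by convention, if $S=\{0\}$ then $\mathcal{Q}(S)=\{0\}$. -}

module Defs where

open import Data.Nat as ℕ using (ℕ; suc; _≤_; NonZero; ≢-nonZero; ≢-nonZero⁻¹)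
open import Data.Nat.GCD using (gcd; gcd[m,n]≢0)
open import Data.Nat.Coprimality using (Coprime)
open import Data.Integer using (+_)
open import Data.Rational as ℚ using (ℚ; _÷_)
open import Data.Fin using (Fin)
open import Data.List using (List; length)
open import Data.List.Relation.Unary.All using (All)
open import Data.List.Relation.Unary.Unique.Propositional using (Unique)
open import Data.List.Membership.Propositional using (_∈_)
open import Data.Product using (Σ; ∃; ∃₂; _×_)
open import Data.Sum using (inj₁)
open import Function.Definitions using (Injective)
open import Relation.Binary.PropositionalEquality using (_≡_)

quotGcd : (x y : ℕ) → .{{NonZero x}} → ℕ
quotGcd x y = ℕ._/_ x (gcd x y) {{≢-nonZero (gcd[m,n]≢0 x y (inj₁ (≢-nonZero⁻¹ x)))}}

InFarey : ℕ → ℚ → Set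
InFarey n q = ∃₂ λ (a b : ℕ) → Σ (NonZero b) λ nz →
  a ≤ b × b ≤ n × Coprime a b × q ≡ ℚ._/_ (+ a) b {{nz}}

QSubFarey : ℕ → List ℚ → Set
QSubFarey n S = ∀ {x y} → x ∈ S → y ∈ S → x ℚ.≤ y → (nz : ℚ.NonZero y) →
  InFarey n (_÷_ x y {{nz}})

-- Statement (A): for all n ≥ 1 and distinct positive a₁..aₙ,
-- max_{i,j} a_i / gcd(a_i,a_j) ≥ n  (the max is attained by some pair i,j)
StatementA : Set
StatementA = ∀ (n : ℕ) → 1 ≤ n → (a : Fin n → ℕ) → Injective _≡_ _≡_ a →
  (pos : ∀ i → NonZero (a i)) →
  ∃₂ λ (i j : Fin n) → n ≤ quotGcd (a i) (a j) {{pos i}}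

StatementB : Set
StatementB = ∀ (n : ℕ) → 1 ≤ n → (S : List ℚ) → Unique S →
  All (InFarey n) S → QSubFarey n S → length S ≤ suc n

-- Write  frac a b  for the rational a/b (a, b natural, b ≠ 0).  In lowest terms its
-- denominator is  b / gcd(b, a) = quotGcd b a,  so for a ≤ b we have
--     frac a b ∈ F_N   ⇔   quotGcd b a ≤ N.
-- This single observation drives both directions.
--
-- (A ⇒ B)  Let S ⊆ F_n with 𝒬(S) ⊆ F_n.  The nonzero elements t₁, …, t_k of S have
-- denominators at most n, hence can be written t_i = a_i / n! with distinct positive a_i.
-- If a_j ≤ a_i then t_j / t_i = a_j / a_i ∈ F_n, i.e. quotGcd a_i a_j ≤ n; if a_i < a_j
-- then quotGcd a_i a_j ≤ quotGcd a_j a_i ≤ n as well.  So (A) forces k ≤ n, and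
-- |S| ≤ k + 1 ≤ n + 1.
--
-- (B ⇒ A)  If distinct positive a₁, …, a_n (n ≥ 2) had all quotGcd a_i a_j ≤ n - 1, then
-- with M = max a_i the set S = {0} ∪ {a_i / M} would satisfy 𝒬(S) ⊆ F_{n-1} (the quotient
-- a_i / a_j reduces to denominator quotGcd a_j a_i) while |S| = n + 1, contradicting (B).
-- For n = 1 the pair (1, 1) witnesses (A) directly.

module Submission where

open import Data.Empty using (⊥; ⊥-elim)
open import Data.Fin as Fin using (Fin)
import Data.Fin.Properties as FinP
import Data.Integer as ℤ
open import Data.Integer using (+_)
import Data.Integer.Properties as ℤP
open import Data.List using (List; []; _∷_; length; lookup; tabulate; filter; allFin)
open import Data.List.Membership.Propositional using (_∈_)
open import Data.List.Membership.Propositional.Properties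
  using (∈-lookup; ∈-filter⁻; ∈-allFin; ∈-tabulate⁻)
import Data.List.Properties as ListP
open import Data.List.Relation.Unary.All as All using (All; _∷_)
import Data.List.Relation.Unary.All.Properties as AllP
open import Data.List.Relation.Unary.AllPairs using (_∷_)
open import Data.List.Relation.Unary.Any using (here; there)
open import Data.List.Relation.Unary.Unique.Propositional using (Unique)
import Data.List.Relation.Unary.Unique.Propositional.Properties as UniqueP
open import Data.Nat as ℕ using (ℕ; zero; suc; NonZero; _≤_; _!; z≤n; s≤s)
import Data.Nat.Properties as ℕP
open import Data.List.Extrema ℕP.≤-totalOrder using (argmax; f[xs]≤f[argmax])
open import Data.Nat.Coprimality using (Coprime; coprime⇒gcd≡1; coprime-/gcd)
open import Data.Nat.Divisibility using (_∣_; ∣-trans; m∣m*n; m≤n⇒m!∣n!; ∣⇒≤; ∣1⇒≡1)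
import Data.Nat.DivMod as DivMod
open import Data.Nat.GCD using (gcd; gcd-comm; gcd[m,n]∣m; gcd[m,n]≢0; n/gcd[m,n]≢0)
open import Data.Product using (Σ; _,_; proj₁; proj₂)
open import Data.Rational as ℚ using (ℚ; _÷_; 0ℚ; 1ℚ; toℚᵘ; ↥_; ↧ₙ_)
import Data.Rational.Properties as ℚP
open import Data.Rational.Unnormalised as ℚᵘ using (mkℚᵘ; *≡*; *≤*)
import Data.Rational.Unnormalised.Properties as ℚᵘP
open import Data.Sum using (inj₁; inj₂)
open import Function.Bundles using (_⇔_; mk⇔)
open import Function.Definitions using (Injective)
open import Relation.Binary.Definitions using (DecidableEquality)
open import Relation.Binary.PropositionalEquality
open import Relation.Nullary using (yes; no; ¬?)
open import Relation.Unary using (Decidable)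

open import Defs

frac : ℕ → (b : ℕ) → .{{NonZero b}} → ℚ
frac a b = (+ a) ℚ./ b

toℚᵘ-frac : ∀ a b' → toℚᵘ (frac a (suc b')) ℚᵘ.≃ mkℚᵘ (+ a) b'
toℚᵘ-frac a b' = ℚP.toℚᵘ-fromℚᵘ (mkℚᵘ (+ a) b')

frac-≡⇐ : ∀ a b c d .{{_ : NonZero b}} .{{_ : NonZero d}} →
          a ℕ.* d ≡ c ℕ.* b → frac a b ≡ frac c d
frac-≡⇐ a b@(suc b') c d@(suc d') e =
  ℚP.fromℚᵘ-cong {mkℚᵘ (+ a) b'} {mkℚᵘ (+ c) d'}
    (*≡* (subst₂ _≡_ (ℤP.pos-* a d) (ℤP.pos-* c b) (cong +_ e)))

frac-≡⇒ : ∀ a b c d .{{_ : NonZero b}} .{{_ : NonZero d}} →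
          frac a b ≡ frac c d → a ℕ.* d ≡ c ℕ.* b
frac-≡⇒ a b@(suc _) c d@(suc _) = ℚP.normalize-injective-≃ a c b d

frac-≤⇐ : ∀ a b c d .{{_ : NonZero b}} .{{_ : NonZero d}} →
          a ℕ.* d ≤ c ℕ.* b → frac a b ℚ.≤ frac c d
frac-≤⇐ a b@(suc b') c d@(suc d') le = ℚP.toℚᵘ-cancel-≤
  (ℚᵘP.≤-respˡ-≃ (ℚᵘP.≃-sym (toℚᵘ-frac a b'))
    (ℚᵘP.≤-respʳ-≃ (ℚᵘP.≃-sym (toℚᵘ-frac c d'))
      (*≤* (subst₂ ℤ._≤_ (ℤP.pos-* a d) (ℤP.pos-* c b) (ℤ.+≤+ le)))))

frac-≤⇒ : ∀ a b c d .{{_ : NonZero b}} .{{_ : NonZero d}} →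
          frac a b ℚ.≤ frac c d → a ℕ.* d ≤ c ℕ.* b
frac-≤⇒ a b@(suc b') c d@(suc d') le
  with ℚᵘP.≤-respˡ-≃ (toℚᵘ-frac a b') (ℚᵘP.≤-respʳ-≃ (toℚᵘ-frac c d') (ℚP.toℚᵘ-mono-≤ le))
... | *≤* le′ = ℤP.drop‿+≤+ (subst₂ ℤ._≤_ (sym (ℤP.pos-* a d)) (sym (ℤP.pos-* c b)) le′)

frac≢0⇒nonZero : ∀ a b .{{_ : NonZero b}} → frac a b ≢ 0ℚ → NonZero a
frac≢0⇒nonZero zero    b ne = ⊥-elim (ne (ℚP.0/n≡0 b))
frac≢0⇒nonZero (suc _) _ _  = _

nonZero⇒frac≢0 : ∀ a b .{{_ : NonZero a}} .{{_ : NonZero b}} → frac a b ≢ 0ℚ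
nonZero⇒frac≢0 a b e = ℕ.≢-nonZero⁻¹ a (trans (sym (ℕP.*-identityʳ a)) (frac-≡⇒ a b 0 1 e))

frac-*-cancel : ∀ a b P .{{_ : NonZero b}} .{{_ : NonZero P}} →
                frac a b ℚ.* frac b P ≡ frac a P
frac-*-cancel a b@(suc b') P@(suc P') = ℚP.toℚᵘ-injective (begin
  toℚᵘ (frac a b ℚ.* frac b P)            ≈⟨ ℚP.toℚᵘ-homo-* (frac a b) (frac b P) ⟩
  toℚᵘ (frac a b) ℚᵘ.* toℚᵘ (frac b P)   ≈⟨ ℚᵘP.*-cong (toℚᵘ-frac a b') (toℚᵘ-frac b P') ⟩
  mkℚᵘ (+ a) b' ℚᵘ.* mkℚᵘ (+ b) P'       ≈⟨ *≡* cross ⟩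
  mkℚᵘ (+ a) P'                           ≈⟨ ℚᵘP.≃-sym (toℚᵘ-frac a P') ⟩
  toℚᵘ (frac a P)                         ∎)
  where
  open ℚᵘP.≃-Reasoning
  cross : (+ a ℤ.* + b) ℤ.* + P ≡ + a ℤ.* + (b ℕ.* P)
  cross = trans (ℤP.*-assoc (+ a) (+ b) (+ P)) (cong (+ a ℤ.*_) (sym (ℤP.pos-* b P)))

÷-commonDenominator : ∀ {x y} a b P .{{_ : NonZero b}} .{{_ : NonZero P}} →
                      x ≡ frac a P → y ≡ frac b P → .{{_ : ℚ.NonZero y}} →
                      x ÷ y ≡ frac a b
÷-commonDenominator a b P refl refl = begin
  frac a P ℚ.* ℚ.1/ y               ≡⟨ cong (ℚ._* ℚ.1/ y) (sym (frac-*-cancel a b P)) ⟩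
  (frac a b ℚ.* y) ℚ.* ℚ.1/ y       ≡⟨ ℚP.*-assoc (frac a b) y (ℚ.1/ y) ⟩
  frac a b ℚ.* (y ℚ.* ℚ.1/ y)       ≡⟨ cong (frac a b ℚ.*_) (ℚP.*-inverseʳ y) ⟩
  frac a b ℚ.* 1ℚ                   ≡⟨ ℚP.*-identityʳ (frac a b) ⟩
  frac a b                          ∎
  where
  open ≡-Reasoning
  y = frac b P

gcd≢0ʳ : ∀ a b .{{_ : NonZero b}} → NonZero (gcd a b)
gcd≢0ʳ a b = ℕ.≢-nonZero (gcd[m,n]≢0 a b (inj₂ (ℕ.≢-nonZero⁻¹ b)))

gcd≢0ˡ : ∀ a b .{{_ : NonZero a}} → NonZero (gcd a b)
gcd≢0ˡ a b = ℕ.≢-nonZero (gcd[m,n]≢0 a b (inj₁ (ℕ.≢-nonZero⁻¹ a)))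

quotGcd≡ : ∀ a b .{{_ : NonZero b}} →
           quotGcd b a ≡ (b ℕ./ gcd a b) {{gcd≢0ʳ a b}}
quotGcd≡ a b = DivMod./-congʳ {{gcd≢0ˡ b a}} {{gcd≢0ʳ a b}} (gcd-comm b a)

↥-frac : ∀ a b .{{_ : NonZero b}} → ↥ frac a b ≡ + (a ℕ./ gcd a b) {{gcd≢0ʳ a b}}
↥-frac a b = ℚP.↥-mkℚ+ _ _ {{ℕ.≢-nonZero (n/gcd[m,n]≢0 a b {{gcd≢0 = gcd≢0ʳ a b}})}}

↧ₙ-frac : ∀ a b .{{_ : NonZero b}} → ↧ₙ frac a b ≡ quotGcd b a
↧ₙ-frac a b = trans
  (ℤP.+-injective (ℚP.↧-mkℚ+ _ _ {{ℕ.≢-nonZero (n/gcd[m,n]≢0 a b {{gcd≢0 = gcd≢0ʳ a b}})}}))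
  (sym (quotGcd≡ a b))

quotGcd-coprime : ∀ a b .{{_ : NonZero b}} → Coprime a b → quotGcd b a ≡ b
quotGcd-coprime a b cop = trans (quotGcd≡ a b)
  (trans (DivMod./-congʳ {{gcd≢0ʳ a b}} (coprime⇒gcd≡1 cop)) (DivMod.n/1≡n b))

-- x / gcd(x, y) ≥ 1 since gcd(x, y) ≤ x; this settles (A) for n = 1.
quotGcd-positive : ∀ x y .{{_ : NonZero x}} → 1 ≤ quotGcd x y
quotGcd-positive x y = DivMod.m≥n⇒m/n>0 {{gcd≢0ˡ x y}} (∣⇒≤ (gcd[m,n]∣m x y))

quotGcd-mono : ∀ x y .{{_ : NonZero x}} .{{_ : NonZero y}} →
               x ≤ y → quotGcd x y ≤ quotGcd y x
quotGcd-mono x y x≤y = ℕP.≤-trans (DivMod./-monoˡ-≤ (gcd x y) {{gcd≢0ˡ x y}} x≤y)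
  (ℕP.≤-reflexive (DivMod./-congʳ {{gcd≢0ˡ x y}} {{gcd≢0ˡ y x}} (gcd-comm x y)))

quotGcd-bound : ∀ N x y .{{_ : NonZero x}} .{{_ : NonZero y}} →
                (y ≤ x → quotGcd x y ≤ N) → (x ≤ y → quotGcd y x ≤ N) →
                quotGcd x y ≤ N
quotGcd-bound N x y ordered reversed with ℕP.≤-total y x
... | inj₁ y≤x = ordered y≤x
... | inj₂ x≤y = ℕP.≤-trans (quotGcd-mono x y x≤y) (reversed x≤y)

farey-zero : ∀ N → 1 ≤ N → InFarey N 0ℚ
farey-zero N 1≤N = 0 , 1 , _ , z≤n , 1≤N , (λ (_ , d∣1) → ∣1⇒≡1 d∣1) , refl

farey-denominator : ∀ N {q} x y .{{_ : NonZero y}} →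
                    InFarey N q → q ≡ frac x y → quotGcd y x ≤ N
farey-denominator N x y (c , d , d≢0 , _ , d≤N , cop , q≡c/d) q≡x/y =
  subst (_≤ N) d≡quotGcd d≤N
  where
  instance _ = d≢0
  d≡quotGcd : d ≡ quotGcd y x
  d≡quotGcd = begin
    d                  ≡⟨ sym (quotGcd-coprime c d cop) ⟩
    quotGcd d c        ≡⟨ sym (↧ₙ-frac c d) ⟩
    ↧ₙ frac c d        ≡⟨ cong ↧ₙ_ (trans (sym q≡c/d) q≡x/y) ⟩
    ↧ₙ frac x y        ≡⟨ ↧ₙ-frac x y ⟩
    quotGcd y x        ∎
    where open ≡-Reasoning

farey-frac : ∀ N a b .{{_ : NonZero b}} → a ≤ b → quotGcd b a ≤ N → InFarey N (frac a b)
farey-frac N a b a≤b bound =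
  a ℕ./ g , b ℕ./ g , b/g≢0 , DivMod./-monoˡ-≤ g a≤b
  , subst (_≤ N) (quotGcd≡ a b) bound , coprime-/gcd a b , lowestTerms
  where
  g = gcd a b
  instance
    g≢0 = gcd≢0ʳ a b
    b/g≢0 : NonZero (b ℕ./ g)
    b/g≢0 = ℕ.≢-nonZero (n/gcd[m,n]≢0 a b)
  lowestTerms : frac a b ≡ frac (a ℕ./ g) (b ℕ./ g)
  lowestTerms = trans (sym (ℚP.↥p/↧p≡p (frac a b)))
    (ℚP./-cong (↥-frac a b) (trans (↧ₙ-frac a b) (quotGcd≡ a b)))

∣-factorial : ∀ {d n} → .{{NonZero d}} → d ≤ n → d ∣ n !
∣-factorial {suc d} d≤n = ∣-trans (m∣m*n (d !)) (m≤n⇒m!∣n! d≤n)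

farey-over-factorial : ∀ n {q} → InFarey n q → Σ ℕ λ a → q ≡ frac a (n !) {{n ℕP.!≢0}}
farey-over-factorial n (p , d , d≢0 , _ , d≤n , _ , q≡p/d) =
  p ℕ.* c , trans q≡p/d (frac-≡⇐ p d (p ℕ.* c) (n !) cross)
  where
  instance
    _ = d≢0
    _ = n ℕP.!≢0
  c = n ! ℕ./ d
  cross : p ℕ.* n ! ≡ p ℕ.* c ℕ.* d
  cross = begin
    p ℕ.* n !          ≡⟨ cong (p ℕ.*_) (sym (DivMod.m/n*n≡m (∣-factorial d≤n))) ⟩
    p ℕ.* (c ℕ.* d)    ≡⟨ sym (ℕP.*-assoc p c d) ⟩
    p ℕ.* c ℕ.* d      ∎
    where open ≡-Reasoning

module _ {A : Set} (_≟_ : DecidableEquality A) where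

  length-deleteValue : ∀ z {xs} → Unique xs →
                       length xs ≤ suc (length (filter (λ x → ¬? (x ≟ z)) xs))
  length-deleteValue z {[]}     _ = z≤n
  length-deleteValue z {x ∷ xs} (x∉xs ∷ u) with x ≟ z
  ... | yes refl = s≤s (ℕP.≤-reflexive (cong length (sym (ListP.filter-all _ ≢z))))
    where ≢z = All.map (λ x≢y y≡x → x≢y (sym y≡x)) x∉xs
  ... | no _     = s≤s (length-deleteValue z u)

lookup-injective : ∀ {A : Set} {xs : List A} → Unique xs →
                   ∀ i j → lookup xs i ≡ lookup xs j → i ≡ j
lookup-injective {xs = _ ∷ _} _          Fin.zero    Fin.zero    _ = refl
lookup-injective              (x∉xs ∷ _) Fin.zero    (Fin.suc j) e =
  ⊥-elim (All.lookup x∉xs (∈-lookup j) e)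
lookup-injective              (x∉xs ∷ _) (Fin.suc i) Fin.zero    e =
  ⊥-elim (All.lookup x∉xs (∈-lookup i) (sym e))
lookup-injective              (_ ∷ u)    (Fin.suc i) (Fin.suc j) e =
  cong Fin.suc (lookup-injective u i j e)

argmax-max : ∀ {m} (a : Fin (suc m) → ℕ) → ∀ i → a i ≤ a (argmax a Fin.zero (allFin _))
argmax-max a i = All.lookup (f[xs]≤f[argmax] {f = a} Fin.zero (allFin _)) (∈-allFin i)

-- (A) ⇒ (B)

module _ (hypA : StatementA) {n : ℕ} {S : List ℚ}
         (S⊆F : All (InFarey n) S) (𝒬S⊆F : QSubFarey n S) where

  nonzero-family-bound : ∀ k (t : Fin k → ℚ) → Injective _≡_ _≡_ t →
                         (∀ i → t i ∈ S) → (∀ i → t i ≢ 0ℚ) → k ≤ n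
  nonzero-family-bound zero        _ _     _   _   = z≤n
  nonzero-family-bound k@(suc _) t t-inj t∈S t≢0 =
    let i , j , k≤quot = hypA k (s≤s z≤n) a a-inj a-pos
    in ℕP.≤-trans k≤quot (quotGcd-bound n (a i) (a j) {{a-pos i}} {{a-pos j}}
                            (ordered i j) (ordered j i))
    where
    instance _ = n ℕP.!≢0
    over-n! : ∀ i → Σ ℕ λ a → t i ≡ frac a (n !)
    over-n! i = farey-over-factorial n (All.lookup S⊆F (t∈S i))
    a : Fin k → ℕ
    a i = proj₁ (over-n! i)
    t≡ : ∀ i → t i ≡ frac (a i) (n !)
    t≡ i = proj₂ (over-n! i)
    a-pos : ∀ i → NonZero (a i)
    a-pos i = frac≢0⇒nonZero (a i) (n !) (λ e → t≢0 i (trans (t≡ i) e))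
    a-inj : Injective _≡_ _≡_ a
    a-inj {i} {j} e = t-inj (trans (t≡ i) (trans (cong (λ x → frac x (n !)) e) (sym (t≡ j))))
    -- t_j / t_i = a_j / a_i lies in F_n whenever a_j ≤ a_i.
    ordered : ∀ i j → a j ≤ a i → quotGcd (a i) (a j) {{a-pos i}} ≤ n
    ordered i j aj≤ai = farey-denominator n (a j) (a i) {{a-pos i}}
      (𝒬S⊆F (t∈S j) (t∈S i) tj≤ti ti≢0)
      (÷-commonDenominator (a j) (a i) (n !) {{a-pos i}} (t≡ j) (t≡ i) {{ti≢0}})
      where
      ti≢0 = ℚ.≢-nonZero (t≢0 i)
      tj≤ti : t j ℚ.≤ t i
      tj≤ti = subst₂ ℚ._≤_ (sym (t≡ j)) (sym (t≡ i))
        (frac-≤⇐ (a j) (n !) (a i) (n !) (ℕP.*-monoˡ-≤ (n !) aj≤ai))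

AtoB : StatementA → StatementB
AtoB hypA n _ S S-unique S⊆F 𝒬S⊆F = ℕP.≤-trans (length-deleteValue ℚ._≟_ 0ℚ S-unique)
  (s≤s (nonzero-family-bound hypA S⊆F 𝒬S⊆F (length T) (lookup T)
         (lookup-injective (UniqueP.filter⁺ ≢0? S-unique) _ _)
         (λ i → proj₁ (∈-filter⁻ ≢0? {xs = S} (∈-lookup i)))
         (λ i → proj₂ (∈-filter⁻ ≢0? {xs = S} (∈-lookup i)))))
  where
  ≢0? : Decidable (_≢ 0ℚ)
  ≢0? x = ¬? (x ℚ.≟ 0ℚ)
  T = filter ≢0? S

-- (B) ⇒ (A)

module _ (hypB : StatementB) {m : ℕ} (a : Fin (suc (suc m)) → ℕ)
         (a-inj : Injective _≡_ _≡_ a) (a-pos : ∀ i → NonZero (a i))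
         (small : ∀ i j → quotGcd (a i) (a j) {{a-pos i}} ≤ suc m) where

  -- Under (B) there are no m + 2 distinct positive integers with all quotGcd ≤ m + 1:
  -- otherwise S = {0} ∪ {a_i / max a} would be an (m+3)-element subset of F_{m+1}
  -- closed under 𝒬.
  no-small-quotients : ⊥
  no-small-quotients = ℕP.<-irrefl refl
    (subst (λ l → suc l ≤ suc (suc m)) (ListP.length-tabulate f)
      (hypB (suc m) (s≤s z≤n) S S-unique S⊆F 𝒬S⊆F))
    where
    K = argmax a Fin.zero (allFin _)
    M = a K
    instance M≢0 = a-pos K
    f : Fin (suc (suc m)) → ℚ
    f i = frac (a i) M
    S : List ℚ
    S = 0ℚ ∷ tabulate f

    f≢0 : ∀ i → f i ≢ 0ℚ
    f≢0 i = nonZero⇒frac≢0 (a i) M {{a-pos i}}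
    f-injective : ∀ {i j} → f i ≡ f j → i ≡ j
    f-injective {i} {j} e = a-inj (ℕP.*-cancelʳ-≡ (a i) (a j) M (frac-≡⇒ (a i) M (a j) M e))
    S-unique : Unique S
    S-unique = AllP.tabulate⁺ {f = f} (λ i e → f≢0 i (sym e))
             ∷ UniqueP.tabulate⁺ {f = f} f-injective
    S⊆F : All (InFarey (suc m)) S
    S⊆F = farey-zero (suc m) (s≤s z≤n)
        ∷ AllP.tabulate⁺ {f = f} (λ i → farey-frac (suc m) (a i) M (argmax-max a i) (small K i))

    -- f i / f j = a_i / a_j, which lies in F_{m+1} when f i ≤ f j.
    ratio : ∀ {x} → Σ (Fin _) (λ i → x ≡ f i) → ∀ j → x ℚ.≤ f j →
            (nz : ℚ.NonZero (f j)) → InFarey (suc m) (_÷_ x (f j) {{nz}})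
    ratio (i , refl) j fi≤fj nz = subst (InFarey (suc m))
      (sym (÷-commonDenominator (a i) (a j) M {{a-pos j}} refl refl {{nz}}))
      (farey-frac (suc m) (a i) (a j) {{a-pos j}} ai≤aj (small j i))
      where
      ai≤aj = ℕP.*-cancelʳ-≤ (a i) (a j) M (frac-≤⇒ (a i) M (a j) M fi≤fj)

    divide-by : ∀ {x y} → Σ (Fin _) (λ j → y ≡ f j) → x ∈ S → x ℚ.≤ y →
                (nz : ℚ.NonZero y) → InFarey (suc m) (_÷_ x y {{nz}})
    divide-by (j , refl) (here refl) _ nz =
      subst (InFarey (suc m)) (sym (ℚP.*-zeroˡ (ℚ.1/_ (f j) {{nz}})))
        (farey-zero (suc m) (s≤s z≤n))
    divide-by (j , refl) (there x∈f) x≤y nz = ratio (∈-tabulate⁻ {f = f} x∈f) j x≤y nz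

    𝒬S⊆F : QSubFarey (suc m) S
    𝒬S⊆F _   (here refl) _ y≢0 = ⊥-elim (ℕ.NonZero.nonZero y≢0)
    𝒬S⊆F x∈S (there y∈f)       = divide-by (∈-tabulate⁻ {f = f} y∈f) x∈S

BtoA : StatementB → StatementA
-- Decide whether some pair reaches n; if none does, n = 1 is impossible and n ≥ 2
-- contradicts no-small-quotients (n = 0 is excluded by 1 ≤ n).
BtoA _ n _ a _ a-pos
  with FinP.any? (λ i → FinP.any? (λ j → n ℕ.≤? quotGcd (a i) (a j) {{a-pos i}}))
... | yes (i , j , n≤quot) = i , j , n≤quot
BtoA _ 1 _ a _ a-pos | no _ =
  Fin.zero , Fin.zero , quotGcd-positive (a Fin.zero) (a Fin.zero) {{a-pos Fin.zero}}
BtoA hypB (suc (suc m)) _ a a-inj a-pos | no none =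
  ⊥-elim (no-small-quotients hypB a a-inj a-pos
    (λ i j → ℕP.≤-pred (ℕP.≰⇒> (λ n≤quot → none (i , j , n≤quot)))))

theorem2 : StatementA ⇔ StatementB
theorem2 = mk⇔ AtoB BtoA
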